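{- For all positive integers $k,n$, the Hamming graph $H_{k,n}$ satisfies $\dim_s(H_{k,n})=(n-1)n^{k-1}$.
   Context: The Hamming graph $H_{k,n}$ is the Cartesian product $K_n\Box K_n\Box\cdots\Box K_n$ of $k$ copies of the complete graph $K_n$, where the Cartesian product $G\Box H$ has vertex set $V(G)\times V(H)$ and $(a,b)\sim(c,d)$ iff ($a=c$ and $bd\in E(H)$) or ($b=d$ and $ac\in E(G)$). For a connected graph $G$, $I_G[u,v]$ is the set of vertices on some shortest $u$–$v$ path. A vertex $w$ strongly resolves $u,v$ if $v\in I_G[u,w]$ or $u\in I_G[v,w]$. A strong resolving set is a set $S\subseteq V(G)$ such that every pair of vertices is strongly resolved by some vertex of $S$; $\dim_s(G)$ is the minimum cardinality of a strong resolving set. -}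

module Defs where

open import Level using (0ℓ)
open import Data.Nat using (ℕ; zero; suc; _≤_)
open import Data.Fin using (Fin)
open import Data.Product using (Σ; _×_; _,_)
open import Data.Sum using (_⊎_)
open import Data.List using (List; length)
open import Data.List.Membership.Propositional using (_∈_)
open import Data.List.Relation.Unary.Unique.Propositional using (Unique)
open import Relation.Nullary using (¬_)
open import Relation.Binary.PropositionalEquality using (_≡_; _≢_)

record Graph : Set₁ where
  field
    V   : Set
    Adj : V → V → Set
open Graph public

K : ℕ → Graph
K n = record { V = Fin n ; Adj = λ i j → i ≢ j }

_□_ : Graph → Graph → Graph
G □ H = record
  { V   = V G × V H
  ; Adj = λ { (a , b) (c , d) → (a ≡ c × Adj H b d) ⊎ (b ≡ d × Adj G a c) } }

-- Hamming graph with (suc k) copies of K_n:  K_n □ (K_n □ ( ... □ K_n)).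
-- HammingS k n = H_{k+1,n}.
HammingS : ℕ → ℕ → Graph
HammingS zero    n = K n
HammingS (suc k) n = K n □ HammingS k n

module _ (G : Graph) where

  data Walk : V G → V G → ℕ → Set where
    nil  : ∀ {u} → Walk u u 0
    cons : ∀ {u v w m} → Adj G u v → Walk v w m → Walk u w (suc m)

  data OnWalk (x : V G) : ∀ {u v m} → Walk u v m → Set where
    here  : ∀ {v m} {p : Walk x v m} → OnWalk x p
    there : ∀ {u u' v m} {e : Adj G u u'} {p : Walk u' v m} → OnWalk x p → OnWalk x (cons e p)

  IsDist : V G → V G → ℕ → Set
  IsDist u v d = Walk u v d × (∀ m → Walk u v m → d ≤ m)

  InInterval : V G → V G → V G → Set
  InInterval u v w = Σ ℕ λ d → IsDist u v d × Σ (Walk u v d) λ p → OnWalk w p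

  StronglyResolves : V G → V G → V G → Set
  StronglyResolves w u v = InInterval u w v ⊎ InInterval v w u

  IsStrongResolvingSet : List (V G) → Set
  IsStrongResolvingSet S = ∀ u v → u ≢ v → Σ (V G) λ w → w ∈ S × StronglyResolves w u v

  IsStrongMetricDim : ℕ → Set
  IsStrongMetricDim m =
    (Σ (List (V G)) λ S → Unique S × IsStrongResolvingSet S × length S ≡ m)
    × (∀ S → Unique S → IsStrongResolvingSet S → m ≤ length S)

-- In H = K_m^{k+1} (m = n + 1) the graph distance is the Hamming distance, so w lies on a
-- geodesic from u to v exactly when d(u,w) + d(w,v) = d(u,v).  Two vertices differing in every
-- coordinate are at the diameter k + 1, and then only u or v itself can strongly resolve them:
-- any strong resolving set contains one endpoint of each such pair.  Shifting a fixed vertex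
-- by i ∈ ℤ/m in every coordinate gives m vertices pairwise at the diameter, and these m-cliques
-- partition the m^{k+1} vertices into m^k classes; a resolving set misses at most one vertex
-- per class, so it has at least n·m^k elements.  Conversely, the n·m^k vertices with nonzero
-- first coordinate form a strong resolving set: a pair containing such a vertex is resolved by
-- it, and u = (0,x), v = (0,y) with x ≠ y is resolved by any w = (j,y) with j ≠ 0, since v lies
-- between u and w.
module Submission where

open import Defs
open import Data.Nat using (ℕ; zero; suc; _+_; _*_; _^_; _∸_; _≤_; z≤n; s≤s)
open import Data.Nat.Properties
  using (+-comm; +-assoc; +-identityʳ; +-mono-≤; +-cancelˡ-≤; ≤-trans; ≤-reflexive; n≤0⇒n≡0;
         <⇒≤; m+[n∸m]≡n; +-commutativeSemigroup; module ≤-Reasoning)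
open import Data.Nat.DivMod using (_%_; _mod_; m%n<n; %-distribˡ-+; m%n%n≡m%n; [m+n]%n≡m%n; m<n⇒m%n≡m)
open import Algebra.Properties.CommutativeSemigroup +-commutativeSemigroup using (interchange)
open import Data.Fin using (Fin; zero; suc; toℕ; punchIn; remQuot; combine)
open import Data.Fin.Properties
  using (_≟_; toℕ-injective; toℕ-fromℕ<; toℕ<n; suc-injective; any?; punchIn-injective;
         punchInᵢ≢i; injective⇒≤; remQuot-combine; combine-remQuot)
open import Data.Product using (Σ; _×_; _,_; proj₁; proj₂; uncurry; map₂)
open import Data.Product.Properties using (≡-dec)
open import Data.Sum using (_⊎_; inj₁; inj₂)
open import Data.Empty using (⊥-elim)
open import Data.List using (List; length; tabulate)
open import Data.List.Properties using (length-tabulate)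
open import Data.List.Membership.Propositional using (_∈_)
open import Data.List.Membership.Propositional.Properties using (∈-tabulate⁺)
open import Data.List.Membership.Setoid.Properties using (index-injective)
open import Data.List.Relation.Unary.Any using (index)
open import Data.List.Relation.Unary.Unique.Propositional.Properties using (tabulate⁺)
open import Function using (_∘_)
open import Relation.Nullary using (yes; no; ¬?)
open import Relation.Nullary.Decidable using (decidable-stable)
open import Relation.Binary.Definitions using (DecidableEquality)
open import Relation.Binary.PropositionalEquality

m+n≤m⇒n≡0 : ∀ m {n} → m + n ≤ m → n ≡ 0
m+n≤m⇒n≡0 m {n} le = n≤0⇒n≡0 (+-cancelˡ-≤ m n 0 (subst (m + n ≤_) (sym (+-identityʳ m)) le))

Fin1-unique : (a b : Fin 1) → a ≡ b
Fin1-unique zero zero = refl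

remQuot-injective : ∀ {p} q {s t : Fin (p * q)} → remQuot {p} q s ≡ remQuot q t → s ≡ t
remQuot-injective {p} q {s} {t} eq = begin
  s                                  ≡⟨ combine-remQuot {p} q s ⟨
  uncurry combine (remQuot {p} q s)  ≡⟨ cong (uncurry combine) eq ⟩
  uncurry combine (remQuot {p} q t)  ≡⟨ combine-remQuot {p} q t ⟩
  t                                  ∎
  where open ≡-Reasoning

module _ {n : ℕ} where
  private
    m : ℕ
    m = suc n

  _⊕_ : Fin m → Fin m → Fin m
  i ⊕ a = (toℕ i + toℕ a) mod m

  toℕ-⊕ : ∀ i a → toℕ (i ⊕ a) ≡ (toℕ i + toℕ a) % m
  toℕ-⊕ i a = toℕ-fromℕ< (m%n<n (toℕ i + toℕ a) m)

  ⊕-comm : ∀ i a → i ⊕ a ≡ a ⊕ i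
  ⊕-comm i a = cong (_mod m) (+-comm (toℕ i) (toℕ a))

  %-absorbˡ : ∀ x y → (x % m + y) % m ≡ (x + y) % m
  %-absorbˡ x y = begin
    (x % m + y) % m          ≡⟨ %-distribˡ-+ (x % m) y m ⟩
    (x % m % m + y % m) % m  ≡⟨ cong (λ z → (z + y % m) % m) (m%n%n≡m%n x m) ⟩
    (x % m + y % m) % m      ≡⟨ %-distribˡ-+ x y m ⟨
    (x + y) % m              ∎
    where open ≡-Reasoning

  ⊕-invertible : ∀ i a → (toℕ (i ⊕ a) + (m ∸ toℕ i)) % m ≡ toℕ a
  ⊕-invertible i a = begin
    (toℕ (i ⊕ a) + -i) % m          ≡⟨ cong (λ r → (r + -i) % m) (toℕ-⊕ i a) ⟩
    ((toℕ i + toℕ a) % m + -i) % m  ≡⟨ %-absorbˡ (toℕ i + toℕ a) -i ⟩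
    (toℕ i + toℕ a + -i) % m        ≡⟨ cong (λ r → (r + -i) % m) (+-comm (toℕ i) (toℕ a)) ⟩
    (toℕ a + toℕ i + -i) % m        ≡⟨ cong (_% m) (+-assoc (toℕ a) (toℕ i) -i) ⟩
    (toℕ a + (toℕ i + -i)) % m      ≡⟨ cong (λ r → (toℕ a + r) % m) (m+[n∸m]≡n (<⇒≤ (toℕ<n i))) ⟩
    (toℕ a + m) % m                 ≡⟨ [m+n]%n≡m%n (toℕ a) m ⟩
    toℕ a % m                       ≡⟨ m<n⇒m%n≡m (toℕ<n a) ⟩
    toℕ a                           ∎
    where
    open ≡-Reasoning
    -i : ℕ
    -i = m ∸ toℕ i

  ⊕-cancelˡ : ∀ i {a b} → i ⊕ a ≡ i ⊕ b → a ≡ b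
  ⊕-cancelˡ i {a} {b} eq = toℕ-injective (begin
    toℕ a                            ≡⟨ ⊕-invertible i a ⟨
    (toℕ (i ⊕ a) + (m ∸ toℕ i)) % m  ≡⟨ cong (λ c → (toℕ c + (m ∸ toℕ i)) % m) eq ⟩
    (toℕ (i ⊕ b) + (m ∸ toℕ i)) % m  ≡⟨ ⊕-invertible i b ⟩
    toℕ b                            ∎)
    where open ≡-Reasoning

  ⊕-cancelʳ : ∀ a {i j} → i ⊕ a ≡ j ⊕ a → i ≡ j
  ⊕-cancelʳ a {i} {j} eq = ⊕-cancelˡ a (trans (⊕-comm a i) (trans eq (⊕-comm j a)))

module _ {A : Set} (_≟ᴬ_ : DecidableEquality A) where
  open import Data.List.Membership.DecPropositional _≟ᴬ_ using (_∈?_)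

  coveredCliques⇒≤length : ∀ {m N} (S : List A) (c : Fin N → Fin (suc m) → A) →
    (∀ {t i t′ i′} → c t i ≡ c t′ i′ → t ≡ t′ × i ≡ i′) →
    (∀ t {i j} → i ≢ j → c t i ∈ S ⊎ c t j ∈ S) →
    m * N ≤ length S
  coveredCliques⇒≤length {m} {N} S c c-injective covered = injective⇒≤ position-injective
    where
    -- Each clique has at most one vertex outside S; its other m vertices inject into S.
    allButOne : ∀ t → Σ (Fin (suc m)) λ i → ∀ j → c t (punchIn i j) ∈ S
    allButOne t with any? (λ i → ¬? (c t i ∈? S))
    ... | yes (i , i∉S) = i , λ j → forced (covered t (punchInᵢ≢i i j ∘ sym))
      where
      forced : ∀ {j} → c t i ∈ S ⊎ c t j ∈ S → c t j ∈ S
      forced (inj₁ i∈S) = ⊥-elim (i∉S i∈S)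
      forced (inj₂ j∈S) = j∈S
    ... | no noneMissing = zero , λ j →
      decidable-stable (c t (punchIn zero j) ∈? S) (λ ∉S → noneMissing (_ , ∉S))

    cell : Fin m × Fin N → A
    cell (j , t) = c t (punchIn (proj₁ (allButOne t)) j)

    cell-injective : ∀ {p q} → cell p ≡ cell q → p ≡ q
    cell-injective {j , t} {j′ , t′} eq with c-injective eq
    ... | refl , punchIn-eq = cong (_, t) (punchIn-injective (proj₁ (allButOne t)) j j′ punchIn-eq)

    cell∈S : ∀ p → cell p ∈ S
    cell∈S (j , t) = proj₂ (allButOne t) j

    position : Fin (m * N) → Fin (length S)
    position x = index (cell∈S (remQuot N x))

    position-injective : ∀ {x y} → position x ≡ position y → x ≡ y
    position-injective {x} {y} eq =
      remQuot-injective N (cell-injective (index-injective (setoid A) (cell∈S _) (cell∈S _) eq))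

module _ {G : Graph} where

  _++ʷ_ : ∀ {u v w a b} → Walk G u v a → Walk G v w b → Walk G u w (a + b)
  nil      ++ʷ q = q
  cons e p ++ʷ q = cons e (p ++ʷ q)

  onWalk-++ʷ : ∀ {u v w a b} (p : Walk G u v a) (q : Walk G v w b) → OnWalk G v (p ++ʷ q)
  onWalk-++ʷ nil        q = here
  onWalk-++ʷ (cons e p) q = there (onWalk-++ʷ p q)

  onWalk⇒split : ∀ {x u w d} (p : Walk G u w d) → OnWalk G x p →
                 Σ ℕ λ a → Σ ℕ λ b → Walk G u x a × Walk G x w b × a + b ≡ d
  onWalk⇒split p here = 0 , _ , nil , p , refl
  onWalk⇒split (cons e p) (there x∈p) with onWalk⇒split p x∈p
  ... | a , b , p₁ , p₂ , a+b≡d = suc a , b , cons e p₁ , p₂ , cong suc a+b≡d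

  walk₀⇒≡ : ∀ {u v} → Walk G u v 0 → u ≡ v
  walk₀⇒≡ nil = refl

module Geodesic (G : Graph) (δ : V G → V G → ℕ)
  (geodesic : ∀ u v → Walk G u v (δ u v))
  (δ≤length : ∀ {u v l} → Walk G u v l → δ u v ≤ l) where

  δ-isDist : ∀ u v → IsDist G u v (δ u v)
  δ-isDist u v = geodesic u v , λ _ → δ≤length

  δ-refl : ∀ u → δ u u ≡ 0
  δ-refl u = n≤0⇒n≡0 (δ≤length nil)

  δ≡0⇒≡ : ∀ {u v} → δ u v ≡ 0 → u ≡ v
  δ≡0⇒≡ {u} {v} eq = walk₀⇒≡ (subst (Walk G u v) eq (geodesic u v))

  ∈-interval⁺ : ∀ {u v w} → δ u v + δ v w ≡ δ u w → InInterval G u w v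
  ∈-interval⁺ {u} {v} {w} eq =
    δ u v + δ v w , subst (IsDist G u w) (sym eq) (δ-isDist u w) ,
    geodesic u v ++ʷ geodesic v w , onWalk-++ʷ (geodesic u v) (geodesic v w)

  ∈-interval⁻ : ∀ {u v w} → InInterval G u w v → δ u v + δ v w ≤ δ u w
  ∈-interval⁻ {u} {v} {w} (d , (_ , minimal) , p , v∈p) with onWalk⇒split p v∈p
  ... | a , b , p₁ , p₂ , a+b≡d = begin
    δ u v + δ v w  ≤⟨ +-mono-≤ (δ≤length p₁) (δ≤length p₂) ⟩
    a + b          ≡⟨ a+b≡d ⟩
    d              ≤⟨ minimal _ (geodesic u w) ⟩
    δ u w          ∎
    where open ≤-Reasoning

  endpoint-∈-interval : ∀ u v → InInterval G u v v
  endpoint-∈-interval u v = ∈-interval⁺ (trans (cong (δ u v +_) (δ-refl v)) (+-identityʳ _))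

  farthest-∈-interval⇒≡ : ∀ {u v w} → InInterval G u w v → δ u w ≤ δ u v → v ≡ w
  farthest-∈-interval⇒≡ {u} {v} {w} v∈[u,w] uw≤uv =
    δ≡0⇒≡ (m+n≤m⇒n≡0 (δ u v) (≤-trans (∈-interval⁻ v∈[u,w]) uw≤uv))

  module _ {D : ℕ} (δ≤D : ∀ x y → δ x y ≤ D) where

    diametral-resolver : ∀ {u v w} → δ u v ≡ D → δ v u ≡ D →
                         StronglyResolves G w u v → w ≡ u ⊎ w ≡ v
    diametral-resolver {u} {v} {w} uv≡D _ (inj₁ v∈[u,w]) =
      inj₂ (sym (farthest-∈-interval⇒≡ v∈[u,w] (subst (δ u w ≤_) (sym uv≡D) (δ≤D u w))))
    diametral-resolver {u} {v} {w} _ vu≡D (inj₂ u∈[v,w]) =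
      inj₁ (sym (farthest-∈-interval⇒≡ u∈[v,w] (subst (δ v w ≤_) (sym vu≡D) (δ≤D v w))))

    diametral-covered : ∀ {S u v} → IsStrongResolvingSet G S → u ≢ v →
                        δ u v ≡ D → δ v u ≡ D → u ∈ S ⊎ v ∈ S
    diametral-covered {S} res u≢v uv≡D vu≡D with res _ _ u≢v
    ... | w , w∈S , w-resolves with diametral-resolver uv≡D vu≡D w-resolves
    ...   | inj₁ refl = inj₁ w∈S
    ...   | inj₂ refl = inj₂ w∈S

module Hamming (n : ℕ) where

  m : ℕ
  m = suc n

  Vertex : ℕ → Set
  Vertex k = V (HammingS k m)

  ≟-vertex : ∀ k → DecidableEquality (Vertex k)
  ≟-vertex zero    = _≟_
  ≟-vertex (suc k) = ≡-dec _≟_ (≟-vertex k)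

  coordDist : Fin m → Fin m → ℕ
  coordDist a b with a ≟ b
  ... | yes _ = 0
  ... | no  _ = 1

  coordDist-refl : ∀ a → coordDist a a ≡ 0
  coordDist-refl a with a ≟ a
  ... | yes _   = refl
  ... | no  a≢a = ⊥-elim (a≢a refl)

  coordDist-≢ : ∀ {a b} → a ≢ b → coordDist a b ≡ 1
  coordDist-≢ {a} {b} a≢b with a ≟ b
  ... | yes a≡b = ⊥-elim (a≢b a≡b)
  ... | no  _   = refl

  coordDist-≤1 : ∀ a b → coordDist a b ≤ 1
  coordDist-≤1 a b with a ≟ b
  ... | yes _ = z≤n
  ... | no  _ = s≤s z≤n

  coordDist-triangle : ∀ a b c → coordDist a c ≤ coordDist a b + coordDist b c
  coordDist-triangle a b c with a ≟ c | a ≟ b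
  ... | yes _   | _        = z≤n
  ... | no  _   | no  _    = s≤s z≤n
  ... | no  a≢c | yes refl = ≤-reflexive (sym (coordDist-≢ a≢c))

  hamming : ∀ k → Vertex k → Vertex k → ℕ
  hamming zero    a       b       = coordDist a b
  hamming (suc k) (a , x) (b , y) = coordDist a b + hamming k x y

  hamming-triangle : ∀ k x y z → hamming k x z ≤ hamming k x y + hamming k y z
  hamming-triangle zero    a b c = coordDist-triangle a b c
  hamming-triangle (suc k) (a , x) (b , y) (c , z) = ≤-trans
    (+-mono-≤ (coordDist-triangle a b c) (hamming-triangle k x y z))
    (≤-reflexive (interchange (coordDist a b) (coordDist b c) (hamming k x y) (hamming k y z)))

  hamming-refl : ∀ k x → hamming k x x ≡ 0
  hamming-refl zero    a       = coordDist-refl a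
  hamming-refl (suc k) (a , x) = cong₂ _+_ (coordDist-refl a) (hamming-refl k x)

  hamming-≤ : ∀ k x y → hamming k x y ≤ suc k
  hamming-≤ zero    a       b       = coordDist-≤1 a b
  hamming-≤ (suc k) (a , x) (b , y) = +-mono-≤ (coordDist-≤1 a b) (hamming-≤ k x y)

  hamming-adjacent : ∀ k {x y} → Adj (HammingS k m) x y → hamming k x y ≤ 1
  hamming-adjacent zero    {a} {b} _ = coordDist-≤1 a b
  hamming-adjacent (suc k) {a , x} {.a , y} (inj₁ (refl , x~y)) =
    subst (_≤ 1) (sym (cong (_+ hamming k x y) (coordDist-refl a))) (hamming-adjacent k x~y)
  hamming-adjacent (suc k) {a , x} {b , .x} (inj₂ (refl , _)) =
    subst (_≤ 1) (sym (trans (cong (coordDist a b +_) (hamming-refl k x)) (+-identityʳ _)))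
      (coordDist-≤1 a b)

  hamming-≤-length : ∀ k {x y l} → Walk (HammingS k m) x y l → hamming k x y ≤ l
  hamming-≤-length k {x} nil = ≤-reflexive (hamming-refl k x)
  hamming-≤-length k {x} {z} (cons {v = y} x~y p) = ≤-trans (hamming-triangle k x y z)
    (+-mono-≤ (hamming-adjacent k x~y) (hamming-≤-length k p))

  headWalk : ∀ k a b (x : Vertex k) → Walk (HammingS (suc k) m) (a , x) (b , x) (coordDist a b)
  headWalk k a b x with a ≟ b
  ... | yes refl = nil
  ... | no  a≢b  = cons (inj₂ (refl , a≢b)) nil

  tailWalk : ∀ k b {x y l} → Walk (HammingS k m) x y l → Walk (HammingS (suc k) m) (b , x) (b , y) l
  tailWalk k b nil          = nil
  tailWalk k b (cons x~y p) = cons (inj₁ (refl , x~y)) (tailWalk k b p)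

  hammingWalk : ∀ k x y → Walk (HammingS k m) x y (hamming k x y)
  hammingWalk zero a b with a ≟ b
  ... | yes refl = nil
  ... | no  a≢b  = cons a≢b nil
  hammingWalk (suc k) (a , x) (b , y) = headWalk k a b x ++ʷ tailWalk k b (hammingWalk k x y)

  module Distance (k : ℕ) = Geodesic (HammingS k m) (hamming k) (hammingWalk k) (hamming-≤-length k)

  shift : ∀ k → Fin m → Vertex k → Vertex k
  shift zero    i a       = i ⊕ a
  shift (suc k) i (a , x) = i ⊕ a , shift k i x

  shift-injective : ∀ k i {x y} → shift k i x ≡ shift k i y → x ≡ y
  shift-injective zero    i eq = ⊕-cancelˡ i eq
  shift-injective (suc k) i eq =
    cong₂ _,_ (⊕-cancelˡ i (cong proj₁ eq)) (shift-injective k i (cong proj₂ eq))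

  shift-diametral : ∀ k {i j} x → i ≢ j → hamming k (shift k i x) (shift k j x) ≡ suc k
  shift-diametral zero    a       i≢j = coordDist-≢ (i≢j ∘ ⊕-cancelʳ a)
  shift-diametral (suc k) (a , x) i≢j =
    cong₂ _+_ (coordDist-≢ (i≢j ∘ ⊕-cancelʳ a)) (shift-diametral k x i≢j)

  vertexAt : ∀ k → Fin (m ^ suc k) → Vertex k
  vertexAt zero    t = proj₁ (remQuot 1 t)
  vertexAt (suc k) t = map₂ (vertexAt k) (remQuot (m ^ suc k) t)

  indexOf : ∀ k → Vertex k → Fin (m ^ suc k)
  indexOf zero    a       = combine a zero
  indexOf (suc k) (a , x) = combine a (indexOf k x)

  vertexAt-indexOf : ∀ k x → vertexAt k (indexOf k x) ≡ x
  vertexAt-indexOf zero    a       = cong proj₁ (remQuot-combine a zero)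
  vertexAt-indexOf (suc k) (a , x) = trans
    (cong (map₂ (vertexAt k)) (remQuot-combine {k = m ^ suc k} a (indexOf k x)))
    (cong (a ,_) (vertexAt-indexOf k x))

  vertexAt-injective : ∀ k {s t} → vertexAt k s ≡ vertexAt k t → s ≡ t
  vertexAt-injective zero    eq = remQuot-injective 1 (cong₂ _,_ eq (Fin1-unique _ _))
  vertexAt-injective (suc k) eq = remQuot-injective (m ^ suc k)
    (cong₂ _,_ (cong proj₁ eq) (vertexAt-injective k (cong proj₂ eq)))

  clique : ∀ k → Fin (m ^ k) → Fin m → Vertex k
  clique zero    _ i = i
  clique (suc k) t i = i , shift k i (vertexAt k t)

  clique-injective : ∀ k {t i t′ i′} → clique k t i ≡ clique k t′ i′ → t ≡ t′ × i ≡ i′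
  clique-injective zero    {t} {t′ = t′} eq = Fin1-unique t t′ , eq
  clique-injective (suc k) eq with cong proj₁ eq
  ... | refl = vertexAt-injective k (shift-injective k _ (cong proj₂ eq)) , refl

  clique-diametral : ∀ k t {i j} → i ≢ j → hamming k (clique k t i) (clique k t j) ≡ suc k
  clique-diametral zero    _ i≢j = coordDist-≢ i≢j
  clique-diametral (suc k) t i≢j =
    cong₂ _+_ (coordDist-≢ i≢j) (shift-diametral k (vertexAt k t) i≢j)

  resolving⇒≤length : ∀ k R → IsStrongResolvingSet (HammingS k m) R → n * m ^ k ≤ length R
  resolving⇒≤length k R res = coveredCliques⇒≤length (≟-vertex k) R (clique k) (clique-injective k)
    λ t {i} {j} i≢j → diametral-covered (hamming-≤ k) res (i≢j ∘ proj₂ ∘ clique-injective k)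
                (clique-diametral k t i≢j) (clique-diametral k t (i≢j ∘ sym))
    where open Distance k using (diametral-covered)

  nonzeroHeaded : ∀ k → Fin n → Fin (m ^ k) → Vertex k
  nonzeroHeaded zero    j _ = suc j
  nonzeroHeaded (suc k) j t = suc j , vertexAt k t

  nonzeroHeaded-injective : ∀ k {j t j′ t′} →
    nonzeroHeaded k j t ≡ nonzeroHeaded k j′ t′ → (j , t) ≡ (j′ , t′)
  nonzeroHeaded-injective zero    {t = t} {t′ = t′} eq = cong₂ _,_ (suc-injective eq) (Fin1-unique t t′)
  nonzeroHeaded-injective (suc k) eq =
    cong₂ _,_ (suc-injective (cong proj₁ eq)) (vertexAt-injective k (cong proj₂ eq))

  nonzeroHeadedSet : ∀ k → List (Vertex k)
  nonzeroHeadedSet k = tabulate (uncurry (nonzeroHeaded k) ∘ remQuot (m ^ k))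

  nonzeroHeaded-∈ : ∀ k j t → nonzeroHeaded k j t ∈ nonzeroHeadedSet k
  nonzeroHeaded-∈ k j t = subst (_∈ nonzeroHeadedSet k)
    (cong (uncurry (nonzeroHeaded k)) (remQuot-combine j t)) (∈-tabulate⁺ (combine j t))

  -- Two distinct vertices exist only if m ≥ 2, i.e. Fin n is inhabited.
  ≢⇒Fin : ∀ k {x y : Vertex k} → x ≢ y → Fin n
  ≢⇒Fin zero    {zero}  {zero}  x≢y = ⊥-elim (x≢y refl)
  ≢⇒Fin zero    {suc j} {_}     _   = j
  ≢⇒Fin zero    {zero}  {suc j} _   = j
  ≢⇒Fin (suc k) {a , x} {b , y} x≢y with a ≟ b
  ... | yes refl = ≢⇒Fin k (x≢y ∘ cong (a ,_))
  ... | no  a≢b  = ≢⇒Fin zero a≢b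

  suc-headed-∈ : ∀ k j y → (suc j , y) ∈ nonzeroHeadedSet (suc k)
  suc-headed-∈ k j y = subst (λ z → (suc j , z) ∈ nonzeroHeadedSet (suc k)) (vertexAt-indexOf k y)
    (nonzeroHeaded-∈ (suc k) j (indexOf k y))

  between-zero-headed : ∀ k j x y →
    hamming (suc k) (zero , x) (zero , y) + hamming (suc k) (zero , y) (suc j , y)
      ≡ hamming (suc k) (zero , x) (suc j , y)
  between-zero-headed k j x y = begin
    (coordDist zero zero + hamming k x y) + (coordDist zero (suc j) + hamming k y y)
      ≡⟨ cong₂ _+_ (cong (_+ hamming k x y) (coordDist-refl zero))
                   (cong₂ _+_ (coordDist-≢ 0≢suc) (hamming-refl k y)) ⟩
    hamming k x y + 1                      ≡⟨ +-comm (hamming k x y) 1 ⟩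
    1 + hamming k x y                      ≡⟨ cong (_+ hamming k x y) (coordDist-≢ 0≢suc) ⟨
    coordDist zero (suc j) + hamming k x y ∎
    where
    open ≡-Reasoning
    0≢suc : zero ≢ suc j
    0≢suc ()

  nonzeroHeadedSet-resolving : ∀ k → IsStrongResolvingSet (HammingS k m) (nonzeroHeadedSet k)
  nonzeroHeadedSet-resolving zero u (suc j) _ =
    suc j , nonzeroHeaded-∈ zero j zero , inj₁ (Distance.endpoint-∈-interval zero u (suc j))
  nonzeroHeadedSet-resolving zero (suc j) zero _ =
    suc j , nonzeroHeaded-∈ zero j zero , inj₂ (Distance.endpoint-∈-interval zero zero (suc j))
  nonzeroHeadedSet-resolving zero zero zero u≢v = ⊥-elim (u≢v refl)
  nonzeroHeadedSet-resolving (suc k) u (suc j , y) _ =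
    (suc j , y) , suc-headed-∈ k j y , inj₁ (Distance.endpoint-∈-interval (suc k) u (suc j , y))
  nonzeroHeadedSet-resolving (suc k) (suc j , x) (zero , y) _ =
    (suc j , x) , suc-headed-∈ k j x ,
    inj₂ (Distance.endpoint-∈-interval (suc k) (zero , y) (suc j , x))
  nonzeroHeadedSet-resolving (suc k) (zero , x) (zero , y) u≢v =
    (suc j , y) , suc-headed-∈ k j y ,
    inj₁ (Distance.∈-interval⁺ (suc k) (between-zero-headed k j x y))
    where
    j : Fin n
    j = ≢⇒Fin k (u≢v ∘ cong (zero ,_))

  strongMetricDim : ∀ k → IsStrongMetricDim (HammingS k m) (n * m ^ k)
  strongMetricDim k =
    (nonzeroHeadedSet k , tabulate⁺ (remQuot-injective (m ^ k) ∘ nonzeroHeaded-injective k) ,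
     nonzeroHeadedSet-resolving k , length-tabulate _) ,
    λ R _ → resolving⇒≤length k R

corollary22 : (k n : ℕ) → IsStrongMetricDim (HammingS k (suc n)) (n * suc n ^ k)
corollary22 k n = Hamming.strongMetricDim n k
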